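{- Let $G$ be an almost bunchy graph and let $H \leq_S G$. If $H$ is $\leq_S$-minimal, then $H$ is isomorphic to $G/\sim_G$. In particular, the set $\{K \mid K\leq_S G\}$ has a unique $\leq_S$-minimal element, namely $G/\sim_G$.
   Context: All graphs are finite directed graphs $G$ with state set $V(G)$, edge set $E(G)$, source/target maps $s,t:E(G)\to V(G)$; loops and parallel edges allowed; all graphs sink-free. $E_I(G)=s^{ -1}(I)$, $F(I)=t(E_I(G))$, $L(G)$ = finite edge paths, $L_I(G)$ = paths starting at $I$. A homomorphism $\Phi:G\to H$ is a pair of maps on edges and states ($\partial\Phi$ on states) commuting with $s,t$. Graphs are identified up to isomorphism. A right-resolver is a surjective homomorphism $\Phi$ with $\Phi|_{E_I(G)}:E_I(G)\to E_{\partial\Phi(I)}(H)$ bijective for every $I$; $\hom_R(G,H)$, and $H\leq_R G$ if nonempty. For each graph $G$ there is a unique $\leq_R$-minimal $M(G)\leq_R G$, and all right-resolvers $G\to M(G)$ have the same state map $\Sigma_G:V(G)\to V(M(G))$. For $\Phi\in\hom_R(G,H)$, $I\cdot u$ (for $u\in L_{\partial\Phi(I)}(H)$) is the endpoint of the unique lift of $u$ starting at $I$. Stability relation: $I_1\sim_\Phi I_2$ iff $\partial\Phi(I_1)=\partial\Phi(I_2)=:I$ and for all $u\in L_I(H)$ there is $v\in L_{t(u)}(H)$ with $I_1\cdot uv=I_2\cdot uv$; it is an equivalence relation invariant under transitions. $\Phi$ is synchronizing if every $\partial\Phi$-fiber is a single $\sim_\Phi$ class; $H\leq_S G$ if a synchronizing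 right-resolver $G\to H$ exists ($\leq_S$ is a partial order); $\leq_S$-minimal means minimal for this order. $G$ is almost bunchy if for each $I,J\in V(M(G))$ there is at most one $I'\in\Sigma_G^{ -1}(I)$ with $|F(I')\cap\Sigma_G^{ -1}(J)|\geq 2$. For almost bunchy $G$, the relation $\sim_\Phi$ is the same for all $\Phi\in\hom_R(G,M(G))$; it is denoted $\sim_G$. For $\Phi\in\hom_R(G,M(G))$, the quotient graph $G/\sim_G$ has states the $\sim_G$ classes, edges the classes of edges under $e_1\sim e_2$ iff $\Phi(e_1)=\Phi(e_2)$ and $s(e_1)\sim_G s(e_2)$, with $s,t$ of a class given by the classes of $s,t$ of a representative. -}

module Defs where

open import Data.Nat using (ℕ)
open import Data.Fin using (Fin)
open import Data.List using (List; []; _∷_; map; _++_)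
open import Data.Product using (Σ; ∃; ∃-syntax; _×_; _,_)
open import Data.Unit using (⊤)
open import Relation.Nullary using (¬_)
open import Relation.Binary.PropositionalEquality using (_≡_)
open import Function.Definitions using (Bijective; Surjective)

record Graph : Set where
  field
    nV nE    : ℕ
    src tgt  : Fin nE → Fin nV
    sinkFree : (I : Fin nV) → ∃[ e ] src e ≡ I
open Graph public

V : Graph → Set
V G = Fin (nV G)

E : Graph → Set
E G = Fin (nE G)

record Hom (G H : Graph) : Set where
  field
    ∂    : V G → V H
    φ    : E G → E H
    src-comm : (e : E G) → src H (φ e) ≡ ∂ (src G e)
    tgt-comm : (e : E G) → tgt H (φ e) ≡ ∂ (tgt G e)
open Hom public

record Iso (G H : Graph) : Set where
  field
    hom   : Hom G H
    ∂-bij : Bijective _≡_ _≡_ (∂ hom)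
    φ-bij : Bijective _≡_ _≡_ (φ hom)

record RightResolver (G H : Graph) : Set where
  field
    hom    : Hom G H
    ∂-surj : Surjective _≡_ _≡_ (∂ hom)
    φ-surj : Surjective _≡_ _≡_ (φ hom)
    local-inj  : (I : V G) (e₁ e₂ : E G) → src G e₁ ≡ I → src G e₂ ≡ I →
                 φ hom e₁ ≡ φ hom e₂ → e₁ ≡ e₂
    local-surj : (I : V G) (e' : E H) → src H e' ≡ ∂ hom I →
                 ∃[ e ] (src G e ≡ I × φ hom e ≡ e')
open RightResolver public

_≤R_ : Graph → Graph → Set
H ≤R G = RightResolver G H

RMinimal : Graph → Set
RMinimal M = (K : Graph) → K ≤R M → Iso K M

IsPathFrom : (G : Graph) → V G → List (E G) → Set
IsPathFrom G I []       = ⊤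
IsPathFrom G I (e ∷ es) = src G e ≡ I × IsPathFrom G (tgt G e) es

endpoint : (G : Graph) → V G → List (E G) → V G
endpoint G I []       = I
endpoint G I (e ∷ es) = endpoint G (tgt G e) es

-- I₁ · w ≡ I₂ · w  : the (unique) lifts of the H-path w starting at I₁ and at I₂
-- end at the same state.
SameEnd : {G H : Graph} (Φ : RightResolver G H) (I₁ I₂ : V G) (w : List (E H)) → Set
SameEnd {G} {H} Φ I₁ I₂ w =
  ∃[ p₁ ] ∃[ p₂ ] (IsPathFrom G I₁ p₁ × IsPathFrom G I₂ p₂ ×
    map (φ (hom Φ)) p₁ ≡ w × map (φ (hom Φ)) p₂ ≡ w ×
    endpoint G I₁ p₁ ≡ endpoint G I₂ p₂)

Stable : {G H : Graph} (Φ : RightResolver G H) → V G → V G → Set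
Stable {G} {H} Φ I₁ I₂ =
  ∂ (hom Φ) I₁ ≡ ∂ (hom Φ) I₂ ×
  ((u : List (E H)) → IsPathFrom H (∂ (hom Φ) I₁) u →
     ∃[ v ] (IsPathFrom H (endpoint H (∂ (hom Φ) I₁) u) v × SameEnd Φ I₁ I₂ (u ++ v)))

Synchronizing : {G H : Graph} → RightResolver G H → Set
Synchronizing {G} Φ = (I₁ I₂ : V G) → ∂ (hom Φ) I₁ ≡ ∂ (hom Φ) I₂ → Stable Φ I₁ I₂

_≤S_ : Graph → Graph → Set
H ≤S G = Σ (RightResolver G H) Synchronizing

SMinimal : Graph → Set
SMinimal H = (K : Graph) → K ≤S H → Iso K H

TwoFollowersIn : {G M : Graph} (Φ : RightResolver G M) → V G → V M → Set
TwoFollowersIn {G} Φ I' J =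
  ∃[ K₁ ] ∃[ K₂ ] (¬ (K₁ ≡ K₂) ×
    (∃[ e₁ ] (src G e₁ ≡ I' × tgt G e₁ ≡ K₁)) ×
    (∃[ e₂ ] (src G e₂ ≡ I' × tgt G e₂ ≡ K₂)) ×
    ∂ (hom Φ) K₁ ≡ J × ∂ (hom Φ) K₂ ≡ J)

-- Almost bunchy, with Σ_G = ∂Φ for a right-resolver Φ : G → M(G).
AlmostBunchy : (G M : Graph) → RightResolver G M → Set
AlmostBunchy G M Φ =
  (I J : V M) (I₁ I₂ : V G) → ∂ (hom Φ) I₁ ≡ I → ∂ (hom Φ) I₂ ≡ I →
  TwoFollowersIn Φ I₁ J → TwoFollowersIn Φ I₂ J → I₁ ≡ I₂

-- Q is (isomorphic to) the quotient graph G/∼_G built from Φ : G → M(G):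
-- there are surjections of states and edges, compatible with source/target,
-- whose kernels are exactly ∼_G on states and the edge relation
-- e₁ ∼ e₂ ⇔ Φ(e₁) = Φ(e₂) ∧ s(e₁) ∼_G s(e₂) on edges.
IsQuotient : (G M : Graph) → RightResolver G M → Graph → Set
IsQuotient G M Φ Q =
  Σ (V G → V Q) λ qV → Σ (E G → E Q) λ qE →
    Surjective _≡_ _≡_ qV × Surjective _≡_ _≡_ qE ×
    ((e : E G) → src Q (qE e) ≡ qV (src G e)) ×
    ((e : E G) → tgt Q (qE e) ≡ qV (tgt G e)) ×
    ((I₁ I₂ : V G) → (qV I₁ ≡ qV I₂ → Stable Φ I₁ I₂) × (Stable Φ I₁ I₂ → qV I₁ ≡ qV I₂)) ×
    ((e₁ e₂ : E G) →
      (qE e₁ ≡ qE e₂ → (φ (hom Φ) e₁ ≡ φ (hom Φ) e₂ × Stable Φ (src G e₁) (src G e₂))) ×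
      ((φ (hom Φ) e₁ ≡ φ (hom Φ) e₂ × Stable Φ (src G e₁) (src G e₂)) → qE e₁ ≡ qE e₂))

-- Stability ∼Φ is recast in the pair graph of Φ (pairs of edges with a common label), where it is
-- decidable and visibly an equivalence relation compatible with edges; so G has a quotient Q = G/∼Φ
-- with a synchronizing right-resolver π : G → Q. Two facts control every other synchronizing
-- right-resolver Ψ : G → H. Since M is ≤R-minimal, Ψ never identifies states that Φ separates; and
-- since G is almost bunchy, ∼ is the same for every right-resolver onto M with the state map of Φ.
-- Hence Ψ identifies only Φ-stable states, π factors as ρ ∘ Ψ with ρ synchronizing, and ≤S-minimality
-- of H makes ρ an isomorphism. Q is itself ≤S-minimal: for synchronizing Λ : Q → K, the composite
-- Λ ∘ π is synchronizing, so Λ cannot identify two states of Q.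

module Submission where

open import Defs
open import Data.Nat using (ℕ; zero; suc; _≤_; _<_; s≤s⁻¹)
open import Data.Nat.Properties using (≤-refl; ≤-trans; 1+n≰n)
open import Data.Fin using (Fin; zero; suc; _≟_; punchOut)
open import Data.Fin.Properties using (any?; all?; punchOut-injective; injective⇒≤)
open import Data.List using (List; []; _∷_; map; _++_; length; filter; allFin; cartesianProduct)
open import Data.List.Properties using (map-++; ∷-injective; filter-notAll)
open import Data.List.Relation.Unary.Any as Any using (here; there; satisfied)
open import Data.List.Membership.Propositional using (_∈_; _∉_; lose)
open import Data.List.Membership.Propositional.Properties using (∈-filter⁺; ∈-allFin; ∈-cartesianProduct⁺)
open import Data.List.Relation.Binary.Subset.Propositional using (_⊆_)
open import Data.Product.Properties using (≡-dec)
open import Data.Product using (Σ; ∃; ∃-syntax; _×_; _,_; proj₁; proj₂)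
open import Data.Empty using (⊥-elim)
open import Data.Sum using (_⊎_; inj₁; inj₂)
open import Data.Unit using (tt)
open import Relation.Nullary using (¬_; Dec; yes; no; ¬?)
open import Relation.Nullary.Decidable using (map′; _×-dec_; _→-dec_)
open import Relation.Binary.Definitions using (DecidableEquality)
open import Relation.Binary.Structures using (IsEquivalence)
open import Relation.Binary.Construct.Closure.ReflexiveTransitive using (Star; ε; _◅_; _◅◅_; reverse)
open import Relation.Binary.PropositionalEquality hiding (J)
open import Function using (_∘_)
open import Function.Construct.Composition using (surjective)

module FiniteReachability {A : Set} (_≟ᴬ_ : DecidableEquality A) (elements : List A)
  (complete : ∀ x → x ∈ elements) {R : A → A → Set} (R? : ∀ x y → Dec (R x y)) where

  visits : ∀ {x z} → Star R x z → List A
  visits ε                 = []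
  visits (_◅_ {j = y} _ p) = y ∷ visits p

  remove : A → List A → List A
  remove y = filter (λ w → ¬? (y ≟ᴬ w))

  remove-< : ∀ {y S} → y ∈ S → length (remove y S) < length S
  remove-< {y} {S} y∈S = filter-notAll (λ w → ¬? (y ≟ᴬ w)) S (Any.map (λ eq ne → ne eq) y∈S)

  -- Intermediate states are pairwise distinct and drawn from S.
  data SimplePath : List A → A → A → Set where
    done : ∀ {S x} → SimplePath S x x
    step : ∀ {S x y z} → R x y → y ∈ S → SimplePath (remove y S) y z → SimplePath S x z

  SimplePath⇒Star : ∀ {S x z} → SimplePath S x z → Star R x z
  SimplePath⇒Star done         = ε
  SimplePath⇒Star (step r _ s) = r ◅ SimplePath⇒Star s

  _∈?_ : ∀ y S → Dec (y ∈ S)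
  y ∈? S = Any.any? (y ≟ᴬ_) S

  shortcut : ∀ {x z} y (p : Star R x z) → y ∈ x ∷ visits p →
    Σ (Star R y z) λ q → y ∉ visits q × visits q ⊆ visits p
  shortcut y ε (here refl) = ε , (λ ()) , λ ()
  shortcut y (_◅_ {j = w} r p) y∈ with y ∈? (w ∷ visits p)
  ... | yes y∈p = let q , y∉q , q⊆p = shortcut y p y∈p in q , y∉q , there ∘ q⊆p
  shortcut y (r ◅ p) (here refl) | no y∉p = r ◅ p , y∉p , λ w∈ → w∈
  shortcut y (r ◅ p) (there y∈p) | no y∉p = ⊥-elim (y∉p y∈p)

  Star⇒SimplePath : ∀ n S → length S ≤ n → ∀ {x z} (p : Star R x z) → visits p ⊆ S → SimplePath S x z
  Star⇒SimplePath n S _ ε _ = done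
  Star⇒SimplePath zero [] _ (_◅_ {j = y} r p) p⊆S with p⊆S (here refl)
  ... | ()
  Star⇒SimplePath (suc n) S l (_◅_ {j = y} r p) p⊆S =
    let q , y∉q , q⊆p = shortcut y p (here refl)
        y∈S = p⊆S (here refl)
    in step r y∈S (Star⇒SimplePath n (remove y S) (s≤s⁻¹ (≤-trans (remove-< y∈S) l)) q
         λ w∈q → ∈-filter⁺ (λ w → ¬? (y ≟ᴬ w)) (p⊆S (there (q⊆p w∈q))) λ { refl → y∉q w∈q })

  SimplePath? : ∀ n S → length S ≤ n → ∀ x z → Dec (SimplePath S x z)
  SimplePath? n S l x z with x ≟ᴬ z
  ... | yes refl = yes done
  SimplePath? zero [] l x z | no x≢z = no λ { done → x≢z refl ; (step _ () _) }
  SimplePath? (suc n) S l x z | no x≢z with Any.any? first-step? elements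
    where
    first-step? : ∀ y → Dec (y ∈ S × R x y × SimplePath (remove y S) y z)
    first-step? y with y ∈? S
    ... | no y∉S = no λ q → y∉S (proj₁ q)
    ... | yes y∈S = map′ (y∈S ,_) proj₂
          (R? x y ×-dec SimplePath? n (remove y S) (s≤s⁻¹ (≤-trans (remove-< y∈S) l)) y z)
  ... | yes found = let _ , y∈S , r , s = satisfied found in yes (step r y∈S s)
  ... | no none = no λ { done → x≢z refl ; (step {y = y} r y∈S s) → none (lose (complete y) (y∈S , r , s)) }

  Star? : ∀ x z → Dec (Star R x z)
  Star? x z = map′ SimplePath⇒Star (λ p → Star⇒SimplePath (length elements) elements ≤-refl p (λ {w} _ → complete w))
    (SimplePath? (length elements) elements ≤-refl x z)

record Enumeration (n : ℕ) (P : Fin n → Set) : Set where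
  field
    size           : ℕ
    element        : Fin size → Fin n
    element-P      : ∀ i → P (element i)
    index          : ∀ x → P x → Fin size
    element-index  : ∀ x p → element (index x p) ≡ x
    index-element  : ∀ i p → index (element i) p ≡ i
    index-irrelevant : ∀ x p q → index x p ≡ index x q

  index-cong : ∀ x y (p : P x) (q : P y) → x ≡ y → index x p ≡ index y q
  index-cong x .x p q refl = index-irrelevant x p q

  index-injective : ∀ x y (p : P x) (q : P y) → index x p ≡ index y q → x ≡ y
  index-injective x y p q eq = trans (sym (element-index x p)) (trans (cong element eq) (element-index y q))

enumerate : ∀ n (P : Fin n → Set) → (∀ x → Dec (P x)) → Enumeration n P
enumerate zero P P? = record
  { size = 0 ; element = λ () ; element-P = λ () ; index = λ ()
  ; element-index = λ () ; index-element = λ () ; index-irrelevant = λ () }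
enumerate (suc n) P P? with P? zero | enumerate n (P ∘ suc) (P? ∘ suc)
... | yes p₀ | E = record
  { size = suc size
  ; element = λ { zero → zero ; (suc i) → suc (element i) }
  ; element-P = λ { zero → p₀ ; (suc i) → element-P i }
  ; index = λ { zero _ → zero ; (suc x) p → suc (index x p) }
  ; element-index = λ { zero _ → refl ; (suc x) p → cong suc (element-index x p) }
  ; index-element = λ { zero _ → refl ; (suc i) p → cong suc (index-element i p) }
  ; index-irrelevant = λ { zero _ _ → refl ; (suc x) p q → cong suc (index-irrelevant x p q) } }
  where open Enumeration E
... | no ¬p₀ | E = record
  { size = size
  ; element = suc ∘ element
  ; element-P = element-P
  ; index = λ { zero p → ⊥-elim (¬p₀ p) ; (suc x) p → index x p }
  ; element-index = λ { zero p → ⊥-elim (¬p₀ p) ; (suc x) p → cong suc (element-index x p) }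
  ; index-element = index-element
  ; index-irrelevant = λ { zero p → ⊥-elim (¬p₀ p) ; (suc x) p q → index-irrelevant x p q } }
  where open Enumeration E

first : ∀ {n} (P : Fin n → Set) → (∀ x → Dec (P x)) → ∃ P → Fin n
first {suc n} P P? w with P? zero
... | yes _ = zero
... | no ¬p₀ = suc (first (P ∘ suc) (P? ∘ suc) (shift w))
  where
  shift : ∃ P → ∃ (P ∘ suc)
  shift (zero , p)  = ⊥-elim (¬p₀ p)
  shift (suc x , p) = x , p

first-P : ∀ {n} (P : Fin n → Set) (P? : ∀ x → Dec (P x)) w → P (first P P? w)
first-P {suc n} P P? w with P? zero
... | yes p = p
... | no _  = first-P (P ∘ suc) (P? ∘ suc) _

first-cong : ∀ {n} (P Q : Fin n → Set) (P? : ∀ x → Dec (P x)) (Q? : ∀ x → Dec (Q x)) w w′ →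
  (∀ x → P x → Q x) → (∀ x → Q x → P x) → first P P? w ≡ first Q Q? w′
first-cong {suc n} P Q P? Q? w w′ P⇒Q Q⇒P with P? zero | Q? zero
... | yes _  | yes _  = refl
... | yes p  | no ¬q  = ⊥-elim (¬q (P⇒Q zero p))
... | no ¬p  | yes q  = ⊥-elim (¬p (Q⇒P zero q))
... | no _   | no _   = cong suc (first-cong (P ∘ suc) (Q ∘ suc) (P? ∘ suc) (Q? ∘ suc) _ _ (P⇒Q ∘ suc) (Q⇒P ∘ suc))

-- If g a ≡ g b with a ≢ b, the section of g misses some c, and punching c out of the section
-- injects Fin (suc m) into Fin m.
surjective⇒injective : ∀ {m} (g : Fin m → Fin m) → (∀ y → ∃[ x ] g x ≡ y) → ∀ a b → g a ≡ g b → a ≡ b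
surjective⇒injective {suc m} g onto a b eq with a ≟ b
... | yes a≡b = a≡b
... | no a≢b = ⊥-elim (1+n≰n (injective⇒≤ {f = punchOut ∘ missed-by} punched-injective))
  where
  s : Fin (suc m) → Fin (suc m)
  s y = proj₁ (onto y)
  gs : ∀ y → g (s y) ≡ y
  gs y = proj₂ (onto y)
  missed : ∃[ c ] ∀ y → ¬ c ≡ s y
  missed with s (g a) ≟ a
  ... | yes sga≡a = b , λ y b≡sy → a≢b (trans (sym sga≡a)
          (trans (cong s (trans eq (trans (cong g b≡sy) (gs y)))) (sym b≡sy)))
  ... | no sga≢a = a , λ y a≡sy → sga≢a (subst (λ z → s z ≡ a) (trans (sym (gs y)) (cong g (sym a≡sy))) (sym a≡sy))
  missed-by : ∀ y → ¬ proj₁ missed ≡ s y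
  missed-by = proj₂ missed
  punched-injective : ∀ {x y} → punchOut (missed-by x) ≡ punchOut (missed-by y) → x ≡ y
  punched-injective {x} {y} q =
    trans (sym (gs x)) (trans (cong g (punchOut-injective (missed-by x) (missed-by y) q)) (gs y))

∂ʳ : {G H : Graph} → RightResolver G H → V G → V H
∂ʳ Φ = ∂ (hom Φ)

φʳ : {G H : Graph} → RightResolver G H → E G → E H
φʳ Φ = φ (hom Φ)

module _ (G : Graph) where

  IsPathFrom-++⁻ : ∀ a p q → IsPathFrom G a (p ++ q) →
    IsPathFrom G a p × IsPathFrom G (endpoint G a p) q
  IsPathFrom-++⁻ a []      q v       = tt , v
  IsPathFrom-++⁻ a (e ∷ p) q (s , v) =
    let v₁ , v₂ = IsPathFrom-++⁻ (tgt G e) p q v in (s , v₁) , v₂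

  IsPathFrom-++⁺ : ∀ a p q → IsPathFrom G a p → IsPathFrom G (endpoint G a p) q →
    IsPathFrom G a (p ++ q)
  IsPathFrom-++⁺ a []      q _         v₂ = v₂
  IsPathFrom-++⁺ a (e ∷ p) q (s , v₁) v₂ = s , IsPathFrom-++⁺ (tgt G e) p q v₁ v₂

  endpoint-++ : ∀ a p q → endpoint G a (p ++ q) ≡ endpoint G (endpoint G a p) q
  endpoint-++ a []      q = refl
  endpoint-++ a (e ∷ p) q = endpoint-++ (tgt G e) p q

module Lifting {G H : Graph} (Φ : RightResolver G H) where

  φ-src : ∀ e → src H (φʳ Φ e) ≡ ∂ʳ Φ (src G e)
  φ-src = src-comm (hom Φ)

  φ-tgt : ∀ e → tgt H (φʳ Φ e) ≡ ∂ʳ Φ (tgt G e)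
  φ-tgt = tgt-comm (hom Φ)

  ∂-src-cong : ∀ {e₁ e₂} → φʳ Φ e₁ ≡ φʳ Φ e₂ → ∂ʳ Φ (src G e₁) ≡ ∂ʳ Φ (src G e₂)
  ∂-src-cong {e₁} {e₂} eq = trans (sym (φ-src e₁)) (trans (cong (src H) eq) (φ-src e₂))

  ∂-tgt-cong : ∀ {e₁ e₂} → φʳ Φ e₁ ≡ φʳ Φ e₂ → ∂ʳ Φ (tgt G e₁) ≡ ∂ʳ Φ (tgt G e₂)
  ∂-tgt-cong {e₁} {e₂} eq = trans (sym (φ-tgt e₁)) (trans (cong (tgt H) eq) (φ-tgt e₂))

  φ-injective : ∀ e₁ e₂ → src G e₁ ≡ src G e₂ → φʳ Φ e₁ ≡ φʳ Φ e₂ → e₁ ≡ e₂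
  φ-injective e₁ e₂ s = local-inj Φ (src G e₁) e₁ e₂ refl (sym s)

  -- When h does not start at ∂ a, lift a h is an arbitrary edge out of a.
  lift : V G → E H → E G
  lift a h with src H h ≟ ∂ʳ Φ a
  ... | yes p = proj₁ (local-surj Φ a h p)
  ... | no _  = proj₁ (sinkFree G a)

  lift-src : ∀ a h → src G (lift a h) ≡ a
  lift-src a h with src H h ≟ ∂ʳ Φ a
  ... | yes p = proj₁ (proj₂ (local-surj Φ a h p))
  ... | no _  = proj₂ (sinkFree G a)

  lift-φ : ∀ a h → src H h ≡ ∂ʳ Φ a → φʳ Φ (lift a h) ≡ h
  lift-φ a h q with src H h ≟ ∂ʳ Φ a
  ... | yes p = proj₂ (proj₂ (local-surj Φ a h p))
  ... | no ¬q = ⊥-elim (¬q q)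

  lift-unique : ∀ a e → src G e ≡ a → lift a (φʳ Φ e) ≡ e
  lift-unique a e s = φ-injective _ e (trans (lift-src a _) (sym s))
    (lift-φ a (φʳ Φ e) (trans (φ-src e) (cong (∂ʳ Φ) s)))

  preimage : V H → V G
  preimage y = proj₁ (∂-surj Φ y)

  ∂-preimage : ∀ y → ∂ʳ Φ (preimage y) ≡ y
  ∂-preimage y = proj₂ (∂-surj Φ y) refl

  IsPathFrom-map : ∀ a p → IsPathFrom G a p → IsPathFrom H (∂ʳ Φ a) (map (φʳ Φ) p)
  IsPathFrom-map a []      _       = tt
  IsPathFrom-map a (e ∷ p) (s , v) = trans (φ-src e) (cong (∂ʳ Φ) s) ,
    subst (λ x → IsPathFrom H x (map (φʳ Φ) p)) (sym (φ-tgt e)) (IsPathFrom-map (tgt G e) p v)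

  endpoint-map : ∀ a p → endpoint H (∂ʳ Φ a) (map (φʳ Φ) p) ≡ ∂ʳ Φ (endpoint G a p)
  endpoint-map a []      = refl
  endpoint-map a (e ∷ p) =
    trans (cong (λ x → endpoint H x (map (φʳ Φ) p)) (φ-tgt e)) (endpoint-map (tgt G e) p)

  lift-path : ∀ a w → IsPathFrom H (∂ʳ Φ a) w →
    Σ (List (E G)) λ p → IsPathFrom G a p × map (φʳ Φ) p ≡ w
  lift-path a []      _       = [] , tt , refl
  lift-path a (h ∷ w) (s , v) =
    let e = lift a h
        eφ = lift-φ a h s
        p , vp , mp = lift-path (tgt G e) w (subst (λ x → IsPathFrom H x w) (trans (sym (cong (tgt H) eφ)) (φ-tgt e)) v)
    in e ∷ p , (lift-src a h , vp) , cong₂ _∷_ eφ mp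

  lift-path-unique : ∀ a p₁ p₂ → IsPathFrom G a p₁ → IsPathFrom G a p₂ →
    map (φʳ Φ) p₁ ≡ map (φʳ Φ) p₂ → p₁ ≡ p₂
  lift-path-unique a []        []        _          _          _  = refl
  lift-path-unique a (e₁ ∷ p₁) (e₂ ∷ p₂) (s₁ , v₁) (s₂ , v₂) m
    with φ-injective e₁ e₂ (trans s₁ (sym s₂)) (proj₁ (∷-injective m))
  ... | refl = cong (e₁ ∷_) (lift-path-unique (tgt G e₁) p₁ p₂ v₁ v₂ (proj₂ (∷-injective m)))

  map-split : ∀ q u w → map (φʳ Φ) q ≡ u ++ w →
    Σ (List (E G)) λ q₁ → Σ (List (E G)) λ q₂ →
      q ≡ q₁ ++ q₂ × map (φʳ Φ) q₁ ≡ u × map (φʳ Φ) q₂ ≡ w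
  map-split q       []      w m = [] , q , refl , refl , m
  map-split (e ∷ q) (h ∷ u) w m =
    let q₁ , q₂ , eq , m₁ , m₂ = map-split q u w (proj₂ (∷-injective m))
    in e ∷ q₁ , q₂ , cong (e ∷_) eq , cong₂ _∷_ (proj₁ (∷-injective m)) m₁ , m₂

  lift-suffix : ∀ a p q u w → IsPathFrom G a p → IsPathFrom G a q →
    map (φʳ Φ) p ≡ u → map (φʳ Φ) q ≡ u ++ w →
    Σ (List (E G)) λ r → IsPathFrom G (endpoint G a p) r × map (φʳ Φ) r ≡ w ×
      endpoint G (endpoint G a p) r ≡ endpoint G a q
  lift-suffix a p q u w vp vq mp mq with map-split q u w mq
  ... | q₁ , q₂ , refl , m₁ , m₂ with IsPathFrom-++⁻ G a q₁ q₂ vq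
  ... | vq₁ , vq₂ with lift-path-unique a q₁ p vq₁ vp (trans m₁ (sym mp))
  ... | refl = q₂ , vq₂ , m₂ , sym (endpoint-++ G a q₁ q₂)

-- Stab is Stable read in the pair graph of Φ, whose edges are pairs of edges of G with a common
-- image: the pairs reached from (a , b) by lifting a common word must all be able to merge.

module PairGraph {G H : Graph} (Φ : RightResolver G H) where
  open Lifting Φ

  data PairStep : V G × V G → V G × V G → Set where
    pair-step : ∀ e₁ e₂ → φʳ Φ e₁ ≡ φʳ Φ e₂ → PairStep (src G e₁ , src G e₂) (tgt G e₁ , tgt G e₂)

  PairPath : V G × V G → V G × V G → Set
  PairPath = Star PairStep

  pair-step′ : ∀ {c d c′ d′} e₁ e₂ → src G e₁ ≡ c → src G e₂ ≡ d → tgt G e₁ ≡ c′ → tgt G e₂ ≡ d′ →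
    φʳ Φ e₁ ≡ φʳ Φ e₂ → PairStep (c , d) (c′ , d′)
  pair-step′ e₁ e₂ refl refl refl refl = pair-step e₁ e₂

  Stab : V G → V G → Set
  Stab a b = ∂ʳ Φ a ≡ ∂ʳ Φ b × (∀ c d → PairPath (a , b) (c , d) → ∃[ x ] PairPath (c , d) (x , x))

  PairPath-diagonal : ∀ {a b c d} → PairPath (a , b) (c , d) → a ≡ b → c ≡ d
  PairPath-diagonal ε eq = eq
  PairPath-diagonal (pair-step e₁ e₂ eq ◅ r) s with φ-injective e₁ e₂ s eq
  ... | refl = PairPath-diagonal r refl

  PairStep-swap : ∀ {a b c d} → PairStep (a , b) (c , d) → PairStep (b , a) (d , c)
  PairStep-swap (pair-step e₁ e₂ eq) = pair-step e₂ e₁ (sym eq)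

  PairPath-swap : ∀ {a b c d} → PairPath (a , b) (c , d) → PairPath (b , a) (d , c)
  PairPath-swap ε = ε
  PairPath-swap (t ◅ r) = PairStep-swap t ◅ PairPath-swap r

  PairPath-∂ : ∀ {a b c d} → PairPath (a , b) (c , d) → ∂ʳ Φ a ≡ ∂ʳ Φ b → ∂ʳ Φ c ≡ ∂ʳ Φ d
  PairPath-∂ ε eq = eq
  PairPath-∂ (pair-step e₁ e₂ eq ◅ r) _ = PairPath-∂ r (∂-tgt-cong eq)

  -- A pair path from (a , c) is a lift of one word; lifting it also from b splits it through b.
  PairPath-interpolate : ∀ {a b c x z} → PairPath (a , c) (x , z) → ∂ʳ Φ b ≡ ∂ʳ Φ a →
    ∃[ y ] PairPath (a , b) (x , y) × PairPath (b , c) (y , z)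
  PairPath-interpolate {b = b} ε _ = b , ε , ε
  PairPath-interpolate {b = b} (pair-step e₁ e₃ eq ◅ r) ∂b =
    let e₂ = lift b (φʳ Φ e₁)
        e₂φ = lift-φ b (φʳ Φ e₁) (trans (φ-src e₁) (sym ∂b))
        y , r₁ , r₂ = PairPath-interpolate r (∂-tgt-cong e₂φ)
    in y , pair-step′ e₁ e₂ refl (lift-src b _) refl refl (sym e₂φ) ◅ r₁
         , pair-step′ e₂ e₃ (lift-src b _) refl refl refl (trans e₂φ eq) ◅ r₂

  Stab-refl : ∀ a → Stab a a
  Stab-refl a = refl , λ c d r → c , subst (λ z → PairPath (c , d) (c , z)) (sym (PairPath-diagonal r refl)) ε

  Stab-sym : ∀ {a b} → Stab a b → Stab b a
  Stab-sym (s , f) = sym s , λ c d r → let x , q = f d c (PairPath-swap r) in x , PairPath-swap q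

  -- Interpolate y via b, merge x with y by some word, read that word from z to z′, and merge using b ∼ c.
  Stab-trans : ∀ {a b c} → Stab a b → Stab b c → Stab a c
  Stab-trans (s₁ , f₁) (s₂ , f₂) = trans s₁ s₂ , λ x z r →
    let y , rab , rbc = PairPath-interpolate r (sym s₁)
        w , q₁ = f₁ x y rab
        z′ , qxz , qyz = PairPath-interpolate q₁ (sym (PairPath-∂ r (trans s₁ s₂)))
        t , q₂ = f₂ w z′ (rbc ◅◅ PairPath-swap qyz)
    in t , (qxz ◅◅ q₂)

  Stab-step : ∀ e₁ e₂ → Stab (src G e₁) (src G e₂) → φʳ Φ e₁ ≡ φʳ Φ e₂ → Stab (tgt G e₁) (tgt G e₂)
  Stab-step e₁ e₂ (s , f) eq = ∂-tgt-cong eq , λ c d r → f c d (pair-step e₁ e₂ eq ◅ r)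

  TwinLifts : V G → V G → V G → V G → Set
  TwinLifts a b c d = Σ (List (E G)) λ p₁ → Σ (List (E G)) λ p₂ →
    IsPathFrom G a p₁ × IsPathFrom G b p₂ × map (φʳ Φ) p₁ ≡ map (φʳ Φ) p₂ ×
    endpoint G a p₁ ≡ c × endpoint G b p₂ ≡ d

  PairPath⇒TwinLifts : ∀ {a b c d} → PairPath (a , b) (c , d) → TwinLifts a b c d
  PairPath⇒TwinLifts ε = [] , [] , tt , tt , refl , refl , refl
  PairPath⇒TwinLifts (pair-step e₁ e₂ eq ◅ r) =
    let p₁ , p₂ , v₁ , v₂ , m , n₁ , n₂ = PairPath⇒TwinLifts r
    in e₁ ∷ p₁ , e₂ ∷ p₂ , (refl , v₁) , (refl , v₂) , cong₂ _∷_ eq m , n₁ , n₂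

  TwinLifts⇒PairPath : ∀ a b c d p₁ p₂ → IsPathFrom G a p₁ → IsPathFrom G b p₂ →
    map (φʳ Φ) p₁ ≡ map (φʳ Φ) p₂ → endpoint G a p₁ ≡ c → endpoint G b p₂ ≡ d → PairPath (a , b) (c , d)
  TwinLifts⇒PairPath a b c d [] [] _ _ _ refl refl = ε
  TwinLifts⇒PairPath a b c d (e₁ ∷ p₁) (e₂ ∷ p₂) (s₁ , v₁) (s₂ , v₂) m n₁ n₂ =
    pair-step′ e₁ e₂ s₁ s₂ refl refl (proj₁ (∷-injective m)) ◅
    TwinLifts⇒PairPath (tgt G e₁) (tgt G e₂) c d p₁ p₂ v₁ v₂ (proj₂ (∷-injective m)) n₁ n₂

  Stable⇒Stab : ∀ a b → Stable Φ a b → Stab a b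
  Stable⇒Stab a b (s , f) = s , λ c d r → merge (PairPath⇒TwinLifts r)
    where
    merge : ∀ {c d} → TwinLifts a b c d → ∃[ x ] PairPath (c , d) (x , x)
    merge (p₁ , p₂ , v₁ , v₂ , m , refl , refl) =
      let w , _ , q₁ , q₂ , w₁ , w₂ , m₁ , m₂ , en = f (map (φʳ Φ) p₁) (IsPathFrom-map a p₁ v₁)
          r₁ , vr₁ , mr₁ , er₁ = lift-suffix a p₁ q₁ _ w v₁ w₁ refl m₁
          r₂ , vr₂ , mr₂ , er₂ = lift-suffix b p₂ q₂ _ w v₂ w₂ (sym m) m₂
      in endpoint G a q₁ ,
         TwinLifts⇒PairPath _ _ _ _ r₁ r₂ vr₁ vr₂ (trans mr₁ (sym mr₂)) er₁ (trans er₂ (sym en))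

  Stab⇒Stable : ∀ a b → Stab a b → Stable Φ a b
  Stab⇒Stable a b (s , f) = s , λ u vu →
    let p₁ , v₁ , m₁ = lift-path a u vu
        p₂ , v₂ , m₂ = lift-path b u (subst (λ z → IsPathFrom H z u) s vu)
        x , q = f _ _ (TwinLifts⇒PairPath a b _ _ p₁ p₂ v₁ v₂ (trans m₁ (sym m₂)) refl refl)
        r₁ , r₂ , w₁ , w₂ , m , n₁ , n₂ = PairPath⇒TwinLifts q
        end-u : ∂ʳ Φ (endpoint G a p₁) ≡ endpoint H (∂ʳ Φ a) u
        end-u = trans (sym (endpoint-map a p₁)) (cong (endpoint H (∂ʳ Φ a)) m₁)
    in map (φʳ Φ) r₁ ,
       subst (λ z → IsPathFrom H z (map (φʳ Φ) r₁)) end-u (IsPathFrom-map _ r₁ w₁) ,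
       p₁ ++ r₁ , p₂ ++ r₂ ,
       IsPathFrom-++⁺ G a p₁ r₁ v₁ w₁ , IsPathFrom-++⁺ G b p₂ r₂ v₂ w₂ ,
       trans (map-++ (φʳ Φ) p₁ r₁) (cong (_++ map (φʳ Φ) r₁) m₁) ,
       trans (map-++ (φʳ Φ) p₂ r₂) (cong₂ _++_ m₂ (sym m)) ,
       trans (endpoint-++ G a p₁ r₁) (trans n₁ (trans (sym n₂) (sym (endpoint-++ G b p₂ r₂))))

  PairStep? : ∀ p q → Dec (PairStep p q)
  PairStep? (c , d) (c′ , d′) = map′
    (λ (e₁ , e₂ , s₁ , s₂ , t₁ , t₂ , eq) → pair-step′ e₁ e₂ s₁ s₂ t₁ t₂ eq)
    (λ { (pair-step e₁ e₂ eq) → e₁ , e₂ , refl , refl , refl , refl , eq })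
    (any? λ e₁ → any? λ e₂ → src G e₁ ≟ c ×-dec src G e₂ ≟ d ×-dec tgt G e₁ ≟ c′ ×-dec tgt G e₂ ≟ d′
                             ×-dec φʳ Φ e₁ ≟ φʳ Φ e₂)

  open FiniteReachability (≡-dec _≟_ _≟_) (cartesianProduct (allFin (nV G)) (allFin (nV G)))
    (λ (c , d) → ∈-cartesianProduct⁺ (∈-allFin c) (∈-allFin d)) PairStep?
    using () renaming (Star? to PairPath?)

  Stab? : ∀ a b → Dec (Stab a b)
  Stab? a b = ∂ʳ Φ a ≟ ∂ʳ Φ b ×-dec
    all? λ c → all? λ d → PairPath? (a , b) (c , d) →-dec any? λ x → PairPath? (c , d) (x , x)

mkResolver : {G H : Graph} (h : Hom G H) → (∀ y → ∃[ x ] ∂ h x ≡ y) →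
  ((I : V G) (e₁ e₂ : E G) → src G e₁ ≡ I → src G e₂ ≡ I → φ h e₁ ≡ φ h e₂ → e₁ ≡ e₂) →
  ((I : V G) (e′ : E H) → src H e′ ≡ ∂ h I → ∃[ e ] (src G e ≡ I × φ h e ≡ e′)) →
  RightResolver G H
mkResolver {G} {H} h ∂-onto li ls = record
  { hom = h
  ; ∂-surj = λ y → let x , eq = ∂-onto y in x , λ { refl → eq }
  ; φ-surj = λ k → let x , eq = ∂-onto (src H k)
                       e , _ , eq′ = ls x k (sym eq)
                   in e , λ { refl → eq′ }
  ; local-inj = li
  ; local-surj = ls }

infixr 9 _∘ʳ_

_∘ʳ_ : {G K M : Graph} → RightResolver K M → RightResolver G K → RightResolver G M
_∘ʳ_ {G} {K} {M} Θ Ξ = mkResolver h ∂-onto li ls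
  where
  module LΘ = Lifting Θ
  module LΞ = Lifting Ξ
  h : Hom G M
  h = record { ∂ = ∂ʳ Θ ∘ ∂ʳ Ξ ; φ = φʳ Θ ∘ φʳ Ξ
             ; src-comm = λ e → trans (LΘ.φ-src (φʳ Ξ e)) (cong (∂ʳ Θ) (LΞ.φ-src e))
             ; tgt-comm = λ e → trans (LΘ.φ-tgt (φʳ Ξ e)) (cong (∂ʳ Θ) (LΞ.φ-tgt e)) }
  ∂-onto : ∀ y → ∃[ x ] ∂ h x ≡ y
  ∂-onto y = LΞ.preimage (LΘ.preimage y) , trans (cong (∂ʳ Θ) (LΞ.∂-preimage _)) (LΘ.∂-preimage y)
  li : (I : V G) (e₁ e₂ : E G) → src G e₁ ≡ I → src G e₂ ≡ I → φ h e₁ ≡ φ h e₂ → e₁ ≡ e₂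
  li I e₁ e₂ s₁ s₂ eq = LΞ.φ-injective e₁ e₂ s₁₂
    (LΘ.φ-injective (φʳ Ξ e₁) (φʳ Ξ e₂)
      (trans (LΞ.φ-src e₁) (trans (cong (∂ʳ Ξ) s₁₂) (sym (LΞ.φ-src e₂)))) eq)
    where
    s₁₂ : src G e₁ ≡ src G e₂
    s₁₂ = trans s₁ (sym s₂)
  ls : (I : V G) (e′ : E M) → src M e′ ≡ ∂ h I → ∃[ e ] (src G e ≡ I × φ h e ≡ e′)
  ls I m s = let k , sk , ek = local-surj Θ (∂ʳ Ξ I) m s
                 e , se , ee = local-surj Ξ I k sk
             in e , se , trans (cong (φʳ Θ) ee) ek

module Factorisation {G H K : Graph} (Ψ : RightResolver G H) (Ξ : RightResolver G K)
  (ker⊆ : ∀ a b → ∂ʳ Ψ a ≡ ∂ʳ Ψ b → ∂ʳ Ξ a ≡ ∂ʳ Ξ b) where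
  private
    module LΨ = Lifting Ψ
    module LΞ = Lifting Ξ

    ∂Θ : V H → V K
    ∂Θ x = ∂ʳ Ξ (LΨ.preimage x)

    liftΨ : E H → E G
    liftΨ h = LΨ.lift (LΨ.preimage (src H h)) h

    φΘ : E H → E K
    φΘ = φʳ Ξ ∘ liftΨ

    liftΨ-φ : ∀ h → φʳ Ψ (liftΨ h) ≡ h
    liftΨ-φ h = LΨ.lift-φ _ h (sym (LΨ.∂-preimage _))

  factor-∂ : ∀ a → ∂Θ (∂ʳ Ψ a) ≡ ∂ʳ Ξ a
  factor-∂ a = ker⊆ _ _ (LΨ.∂-preimage (∂ʳ Ψ a))

  factor : RightResolver H K
  factor = mkResolver h ∂-onto li ls
    where
    h : Hom H K
    h = record
      { ∂ = ∂Θ ; φ = φΘ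
      ; src-comm = λ h → trans (LΞ.φ-src _) (cong (∂ʳ Ξ) (LΨ.lift-src _ h))
      ; tgt-comm = λ h → trans (LΞ.φ-tgt _) (sym (ker⊆ _ _
          (trans (LΨ.∂-preimage (tgt H h)) (trans (cong (tgt H) (sym (liftΨ-φ h))) (LΨ.φ-tgt _))))) }
    ∂-onto : ∀ y → ∃[ x ] ∂Θ x ≡ y
    ∂-onto y = ∂ʳ Ψ (LΞ.preimage y) , trans (factor-∂ _) (LΞ.∂-preimage y)
    li : (I : V H) (h₁ h₂ : E H) → src H h₁ ≡ I → src H h₂ ≡ I → φΘ h₁ ≡ φΘ h₂ → h₁ ≡ h₂
    li I h₁ h₂ refl s₂ eq =
      let same-src = trans (LΨ.lift-src _ h₁) (trans (cong LΨ.preimage (sym s₂)) (sym (LΨ.lift-src _ h₂)))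
      in trans (sym (liftΨ-φ h₁)) (trans (cong (φʳ Ψ) (LΞ.φ-injective _ _ same-src eq)) (liftΨ-φ h₂))
    ls : (I : V H) (k : E K) → src K k ≡ ∂Θ I → ∃[ h ] (src H h ≡ I × φΘ h ≡ k)
    ls I k s =
      let e = LΞ.lift (LΨ.preimage I) k
          h = φʳ Ψ e
          sh : src H h ≡ I
          sh = trans (LΨ.φ-src e) (trans (cong (∂ʳ Ψ) (LΞ.lift-src _ k)) (LΨ.∂-preimage I))
          back : liftΨ h ≡ e
          back = subst (λ z → LΨ.lift (LΨ.preimage z) h ≡ e) (sym sh) (LΨ.lift-unique _ e (LΞ.lift-src _ k))
      in h , sh , trans (cong (φʳ Ξ) back) (LΞ.lift-φ _ k s)

module Composite {G K M : Graph} (Θ : RightResolver K M) (Ξ : RightResolver G K) where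
  private
    module LΘ = Lifting Θ
    module LΞ = Lifting Ξ
    module PΘ = PairGraph Θ
    module PΞ = PairGraph Ξ
    module PΘΞ = PairGraph (Θ ∘ʳ Ξ)

  ∂-∘-preimage : ∀ {x y} → ∂ʳ Θ x ≡ ∂ʳ Θ y → ∂ʳ (Θ ∘ʳ Ξ) (LΞ.preimage x) ≡ ∂ʳ (Θ ∘ʳ Ξ) (LΞ.preimage y)
  ∂-∘-preimage {x} {y} eq = trans (cong (∂ʳ Θ) (LΞ.∂-preimage x)) (trans eq (cong (∂ʳ Θ) (sym (LΞ.∂-preimage y))))

  PairPath-∘⁺ : ∀ {p q} → PΞ.PairPath p q → PΘΞ.PairPath p q
  PairPath-∘⁺ ε = ε
  PairPath-∘⁺ (PΞ.pair-step e₁ e₂ eq ◅ r) = PΘΞ.pair-step e₁ e₂ (cong (φʳ Θ) eq) ◅ PairPath-∘⁺ r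

  PairPath-∘⁻ : ∀ {c d q} → ∂ʳ Ξ c ≡ ∂ʳ Ξ d → PΘΞ.PairPath (c , d) q → PΞ.PairPath (c , d) q
  PairPath-∘⁻ _ ε = ε
  PairPath-∘⁻ s (PΘΞ.pair-step e₁ e₂ eq ◅ r) =
    let eq′ = LΘ.φ-injective (φʳ Ξ e₁) (φʳ Ξ e₂) (trans (LΞ.φ-src e₁) (trans s (sym (LΞ.φ-src e₂)))) eq
    in PΞ.pair-step e₁ e₂ eq′ ◅ PairPath-∘⁻ (LΞ.∂-tgt-cong eq′) r

  PairPath-image : ∀ {c d c′ d′} → PΘΞ.PairPath (c , d) (c′ , d′) →
    PΘ.PairPath (∂ʳ Ξ c , ∂ʳ Ξ d) (∂ʳ Ξ c′ , ∂ʳ Ξ d′)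
  PairPath-image ε = ε
  PairPath-image (PΘΞ.pair-step e₁ e₂ eq ◅ r) =
    PΘ.pair-step′ (φʳ Ξ e₁) (φʳ Ξ e₂) (LΞ.φ-src e₁) (LΞ.φ-src e₂) (LΞ.φ-tgt e₁) (LΞ.φ-tgt e₂) eq ◅
    PairPath-image r

  PairPath-lift : ∀ {x y u w} c d → ∂ʳ Ξ c ≡ x → ∂ʳ Ξ d ≡ y → PΘ.PairPath (x , y) (u , w) →
    ∃[ c′ ] ∃[ d′ ] PΘΞ.PairPath (c , d) (c′ , d′) × ∂ʳ Ξ c′ ≡ u × ∂ʳ Ξ d′ ≡ w
  PairPath-lift c d sc sd ε = c , d , ε , sc , sd
  PairPath-lift c d sc sd (PΘ.pair-step f₁ f₂ eq ◅ r) =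
    let e₁ = LΞ.lift c f₁
        e₂ = LΞ.lift d f₂
        q₁ = LΞ.lift-φ c f₁ (sym sc)
        q₂ = LΞ.lift-φ d f₂ (sym sd)
        c′ , d′ , r′ , s₁ , s₂ = PairPath-lift (tgt G e₁) (tgt G e₂)
          (trans (sym (LΞ.φ-tgt e₁)) (cong (tgt K) q₁)) (trans (sym (LΞ.φ-tgt e₂)) (cong (tgt K) q₂)) r
    in c′ , d′ ,
       PΘΞ.pair-step′ e₁ e₂ (LΞ.lift-src c f₁) (LΞ.lift-src d f₂) refl refl
         (trans (cong (φʳ Θ) q₁) (trans eq (cong (φʳ Θ) (sym q₂)))) ◅ r′ ,
       s₁ , s₂

  Stab-∘⁺ : ∀ {a b} → PΞ.Stab a b → PΘΞ.Stab a b
  Stab-∘⁺ (s , f) = cong (∂ʳ Θ) s , λ c d r → let x , q = f c d (PairPath-∘⁻ s r) in x , PairPath-∘⁺ q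

  Stab-∘⁻ : ∀ {a b} → PΘΞ.Stab a b → ∂ʳ Ξ a ≡ ∂ʳ Ξ b → PΞ.Stab a b
  Stab-∘⁻ (_ , f) s = s , λ c d r → let x , q = f c d (PairPath-∘⁺ r) in x , PairPath-∘⁻ (PΞ.PairPath-∂ r s) q

  Stab-image : ∀ {a b} → PΘΞ.Stab a b → PΘ.Stab (∂ʳ Ξ a) (∂ʳ Ξ b)
  Stab-image {a} {b} (s , f) = s , λ u w r →
    let c′ , d′ , r′ , s₁ , s₂ = PairPath-lift a b refl refl r
        x , q = f c′ d′ r′
    in ∂ʳ Ξ x , subst₂ (λ i j → PΘ.PairPath (i , j) (∂ʳ Ξ x , ∂ʳ Ξ x)) s₁ s₂ (PairPath-image q)

  -- Merge the images in K first, lift that merging word back to G, then merge inside a Ξ-fibre.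
  Synchronizing-∘ : Synchronizing Θ → Synchronizing Ξ → Synchronizing (Θ ∘ʳ Ξ)
  Synchronizing-∘ syncΘ syncΞ a b s = PΘΞ.Stab⇒Stable a b (s , λ c d r →
    let y , q = proj₂ (PΘ.Stable⇒Stab _ _ (syncΘ (∂ʳ Ξ a) (∂ʳ Ξ b) s)) _ _ (PairPath-image r)
        c′ , d′ , r′ , s₁ , s₂ = PairPath-lift c d refl refl q
        x , q′ = proj₂ (PΞ.Stable⇒Stab c′ d′ (syncΞ c′ d′ (trans s₁ (sym s₂)))) c′ d′ ε
    in x , (r′ ◅◅ PairPath-∘⁺ q′))

Iso-from-∂-injective : ∀ {Q K} (Λ : RightResolver Q K) → (∀ x y → ∂ʳ Λ x ≡ ∂ʳ Λ y → x ≡ y) → Iso K Q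
Iso-from-∂-injective {Q} {K} Λ ∂-inj = record
  { hom = h
  ; ∂-bij = (λ {x} {y} eq → trans (sym (L.∂-preimage x)) (trans (cong (∂ʳ Λ) eq) (L.∂-preimage y))) ,
            λ y → ∂ʳ Λ y , λ { refl → ∂-inj _ _ (L.∂-preimage _) }
  ; φ-bij = (λ {x} {y} eq → trans (sym (φ-section x)) (trans (cong (φʳ Λ) eq) (φ-section y))) ,
            λ y → φʳ Λ y , λ { refl → φ-inj _ _ (φ-section _) } }
  where
  module L = Lifting Λ
  φ-preimage : E K → E Q
  φ-preimage k = proj₁ (φ-surj Λ k)
  φ-section : ∀ k → φʳ Λ (φ-preimage k) ≡ k
  φ-section k = proj₂ (φ-surj Λ k) refl
  φ-inj : ∀ h₁ h₂ → φʳ Λ h₁ ≡ φʳ Λ h₂ → h₁ ≡ h₂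
  φ-inj h₁ h₂ eq = L.φ-injective h₁ h₂ (∂-inj _ _ (L.∂-src-cong eq)) eq
  h : Hom K Q
  h = record
    { ∂ = L.preimage ; φ = φ-preimage
    ; src-comm = λ k → ∂-inj _ _
        (trans (sym (L.φ-src _)) (trans (cong (src K) (φ-section k)) (sym (L.∂-preimage _))))
    ; tgt-comm = λ k → ∂-inj _ _
        (trans (sym (L.φ-tgt _)) (trans (cong (tgt K) (φ-section k)) (sym (L.∂-preimage _)))) }

AlmostBunchy-∂ : ∀ {G M} (Φ₁ Φ₂ : RightResolver G M) → (∀ a → ∂ʳ Φ₂ a ≡ ∂ʳ Φ₁ a) →
  AlmostBunchy G M Φ₁ → AlmostBunchy G M Φ₂
AlmostBunchy-∂ Φ₁ Φ₂ same-∂ AB I J I₁ I₂ p₁ p₂ t₁ t₂ =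
  AB (∂ʳ Φ₁ I₁) J I₁ I₂ refl (trans (sym (same-∂ I₂)) (trans p₂ (trans (sym p₁) (same-∂ I₁)))) (conv t₁) (conv t₂)
  where
  conv : ∀ {c} → TwoFollowersIn Φ₂ c J → TwoFollowersIn Φ₁ c J
  conv (K₁ , K₂ , K₁≢K₂ , x₁ , x₂ , q₁ , q₂) =
    K₁ , K₂ , K₁≢K₂ , x₁ , x₂ , trans (sym (same-∂ K₁)) q₁ , trans (sym (same-∂ K₂)) q₂

-- Off the diagonal, almost bunchiness lets one of the two edges of a Φ₁-pair step, the one leaving a
-- state with a single follower in the target fibre, be replaced by a Φ₂-lift of the other's Φ₂-label.
module PairPathTransfer {G M : Graph} (Φ₁ Φ₂ : RightResolver G M) (same-∂ : ∀ a → ∂ʳ Φ₂ a ≡ ∂ʳ Φ₁ a)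
  (AB : AlmostBunchy G M Φ₁) where
  private
    module L₁ = Lifting Φ₁
    module L₂ = Lifting Φ₂
    module P₁ = PairGraph Φ₁
    module P₂ = PairGraph Φ₂
    σ : V G → V M
    σ = ∂ʳ Φ₁

  SingleFollower : V G → V M → Set
  SingleFollower c J = ∀ e₁ e₂ → src G e₁ ≡ c → src G e₂ ≡ c →
    σ (tgt G e₁) ≡ J → σ (tgt G e₂) ≡ J → tgt G e₁ ≡ tgt G e₂

  TwoFollowerEdges : V G → V M → Set
  TwoFollowerEdges c J = ∃[ e₁ ] ∃[ e₂ ] src G e₁ ≡ c × src G e₂ ≡ c ×
    σ (tgt G e₁) ≡ J × σ (tgt G e₂) ≡ J × ¬ tgt G e₁ ≡ tgt G e₂

  TwoFollowerEdges? : ∀ c J → Dec (TwoFollowerEdges c J)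
  TwoFollowerEdges? c J = any? λ e₁ → any? λ e₂ → src G e₁ ≟ c ×-dec src G e₂ ≟ c ×-dec
    σ (tgt G e₁) ≟ J ×-dec σ (tgt G e₂) ≟ J ×-dec ¬? (tgt G e₁ ≟ tgt G e₂)

  SingleFollower-or-two : ∀ c J → SingleFollower c J ⊎ TwoFollowersIn Φ₁ c J
  SingleFollower-or-two c J with TwoFollowerEdges? c J
  ... | yes (e₁ , e₂ , s₁ , s₂ , t₁ , t₂ , ne) =
    inj₂ (tgt G e₁ , tgt G e₂ , ne , (e₁ , s₁ , refl) , (e₂ , s₂ , refl) , t₁ , t₂)
  ... | no none = inj₁ decide
    where
    decide : SingleFollower c J
    decide e₁ e₂ s₁ s₂ t₁ t₂ with tgt G e₁ ≟ tgt G e₂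
    ... | yes eq = eq
    ... | no ne = ⊥-elim (none (e₁ , e₂ , s₁ , s₂ , t₁ , t₂ , ne))

  SingleFollower-either : ∀ c d J → σ c ≡ σ d → ¬ c ≡ d → SingleFollower c J ⊎ SingleFollower d J
  SingleFollower-either c d J s c≢d with SingleFollower-or-two c J | SingleFollower-or-two d J
  ... | inj₁ single | _            = inj₁ single
  ... | inj₂ _      | inj₁ single  = inj₂ single
  ... | inj₂ two₁   | inj₂ two₂    = ⊥-elim (c≢d (AB (σ c) J c d refl (sym s) two₁ two₂))

  replace-edge : ∀ e₁ e₂ → SingleFollower (src G e₁) (σ (tgt G e₁)) → φʳ Φ₁ e₁ ≡ φʳ Φ₁ e₂ →
    P₂.PairStep (src G e₁ , src G e₂) (tgt G e₁ , tgt G e₂)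
  replace-edge e₁ e₂ single eq = P₂.pair-step′ e₁′ e₂ (L₂.lift-src _ h) refl same-tgt refl φe₁′
    where
    h : E M
    h = φʳ Φ₂ e₂
    e₁′ : E G
    e₁′ = L₂.lift (src G e₁) h
    φe₁′ : φʳ Φ₂ e₁′ ≡ h
    φe₁′ = L₂.lift-φ _ h (trans (L₂.φ-src e₂)
      (trans (same-∂ _) (trans (sym (L₁.∂-src-cong eq)) (sym (same-∂ _)))))
    same-tgt : tgt G e₁′ ≡ tgt G e₁
    same-tgt = single e₁′ e₁ (L₂.lift-src _ h) refl
      (trans (sym (same-∂ _)) (trans (L₂.∂-tgt-cong φe₁′) (trans (same-∂ _) (L₁.∂-tgt-cong (sym eq)))))
      refl

  PairStep-transfer : ∀ {c d q} → P₁.PairStep (c , d) q → ¬ c ≡ d → P₂.PairStep (c , d) q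
  PairStep-transfer (P₁.pair-step e₁ e₂ eq) c≢d
    with SingleFollower-either (src G e₁) (src G e₂) (σ (tgt G e₁)) (L₁.∂-src-cong eq) c≢d
  ... | inj₁ single = replace-edge e₁ e₂ single eq
  ... | inj₂ single = P₂.PairStep-swap (replace-edge e₂ e₁
          (subst (SingleFollower (src G e₂)) (L₁.∂-tgt-cong eq) single) (sym eq))

  Merges₂ : V G → V G → Set
  Merges₂ c d = ∃[ x ] P₂.PairPath (c , d) (x , x)

  PairPath-transfer : ∀ {c d c′ d′} → P₁.PairPath (c , d) (c′ , d′) →
    P₂.PairPath (c , d) (c′ , d′) ⊎ (Merges₂ c d × c′ ≡ d′)
  PairPath-transfer ε = inj₁ ε
  PairPath-transfer {c} {d} (t ◅ r) with c ≟ d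
  ... | yes refl = inj₂ ((c , ε) , P₁.PairPath-diagonal (t ◅ r) refl)
  ... | no c≢d with PairPath-transfer r
  ...   | inj₁ r₂               = inj₁ (PairStep-transfer t c≢d ◅ r₂)
  ...   | inj₂ ((x , r₂) , c′≡d′) = inj₂ ((x , PairStep-transfer t c≢d ◅ r₂) , c′≡d′)

Stab-same-∂ : ∀ {G M} (Φ₁ Φ₂ : RightResolver G M) → (∀ a → ∂ʳ Φ₂ a ≡ ∂ʳ Φ₁ a) → AlmostBunchy G M Φ₁ →
  ∀ {a b} → PairGraph.Stab Φ₁ a b → PairGraph.Stab Φ₂ a b
Stab-same-∂ Φ₁ Φ₂ same-∂ AB {a} {b} (s , f) = trans (same-∂ a) (trans s (sym (same-∂ b))) , λ c d → merges
  where
  open PairPathTransfer Φ₁ Φ₂ same-∂ AB using (Merges₂) renaming (PairPath-transfer to to₂)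
  open PairPathTransfer Φ₂ Φ₁ (sym ∘ same-∂) (AlmostBunchy-∂ Φ₁ Φ₂ same-∂ AB)
    using () renaming (PairPath-transfer to to₁)
  merges : ∀ {c d} → PairGraph.PairPath Φ₂ (a , b) (c , d) → Merges₂ c d
  merges {c} r with to₁ r
  ... | inj₂ (_ , refl) = c , ε
  ... | inj₁ r₁ with f _ _ r₁
  ...   | x , q with to₂ q
  ...     | inj₁ q₂ = x , q₂
  ...     | inj₂ (merged , _) = merged

record OutMatching (G : Graph) (R : V G → V G → Set) (a b : V G) : Set where
  field
    to from  : E G → E G
    to-src   : ∀ e → src G e ≡ a → src G (to e) ≡ b
    to-tgt   : ∀ e → src G e ≡ a → R (tgt G (to e)) (tgt G e)
    from-src : ∀ e → src G e ≡ b → src G (from e) ≡ a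
    from-to  : ∀ e → src G e ≡ a → from (to e) ≡ e
    to-from  : ∀ e → src G e ≡ b → to (from e) ≡ e

OutMatching-refl : ∀ {G R} a → (∀ {x} → R x x) → OutMatching G R a a
OutMatching-refl {G} a R-refl = record
  { to = λ e → e ; from = λ e → e ; to-src = λ _ s → s ; to-tgt = λ _ _ → R-refl
  ; from-src = λ _ s → s ; from-to = λ _ _ → refl ; to-from = λ _ _ → refl }

OutMatching-trans : ∀ {G R a b c} → (∀ {x y z} → R x y → R y z → R x z) →
  OutMatching G R a b → OutMatching G R b c → OutMatching G R a c
OutMatching-trans R-trans m₁ m₂ = record
  { to = M₂.to ∘ M₁.to ; from = M₁.from ∘ M₂.from
  ; to-src = λ e s → M₂.to-src _ (M₁.to-src e s)
  ; to-tgt = λ e s → R-trans (M₂.to-tgt _ (M₁.to-src e s)) (M₁.to-tgt e s)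
  ; from-src = λ e s → M₁.from-src _ (M₂.from-src e s)
  ; from-to = λ e s → trans (cong M₁.from (M₂.from-to _ (M₁.to-src e s))) (M₁.from-to e s)
  ; to-from = λ e s → trans (cong M₂.to (M₁.to-from _ (M₂.from-src e s))) (M₂.to-from e s) }
  where
  module M₁ = OutMatching m₁
  module M₂ = OutMatching m₂

-- States of the quotient are the least elements of the R-classes; its edges are the edges leaving them,
-- and an edge of G is sent to the edge it is matched with at the representative of its source.
module QuotientGraph (G : Graph) {R : V G → V G → Set} (R? : ∀ a b → Dec (R a b))
  (R-equiv : IsEquivalence R) (matching : ∀ {a b} → R a b → OutMatching G R a b) where
  open IsEquivalence R-equiv using () renaming (refl to R-refl; sym to R-sym; trans to R-trans)

  opaque
    rep : V G → V G
    rep a = first (R a) (R? a) (a , R-refl)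

    R-rep : ∀ a → R a (rep a)
    R-rep a = first-P (R a) (R? a) _

    rep-cong : ∀ {a b} → R a b → rep a ≡ rep b
    rep-cong {a} {b} r = first-cong (R a) (R b) (R? a) (R? b) _ _ (λ _ → R-trans (R-sym r)) (λ _ → R-trans r)

  rep-idem : ∀ a → rep (rep a) ≡ rep a
  rep-idem a = rep-cong (R-sym (R-rep a))

  private
    module Vq = Enumeration (enumerate (nV G) (λ x → rep x ≡ x) (λ x → rep x ≟ x))
    module Eq = Enumeration (enumerate (nE G) (λ e → rep (src G e) ≡ src G e) (λ e → rep (src G e) ≟ src G e))

  Q : Graph
  Q = record
    { nV = Vq.size
    ; nE = Eq.size
    ; src = λ i → Vq.index (src G (Eq.element i)) (Eq.element-P i)
    ; tgt = λ i → Vq.index (rep (tgt G (Eq.element i))) (rep-idem _)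
    ; sinkFree = λ i →
        let e , se = sinkFree G (Vq.element i)
            p = subst (λ z → rep z ≡ z) (sym se) (Vq.element-P i)
        in Eq.index e p ,
           trans (Vq.index-cong _ _ _ _ (trans (cong (src G) (Eq.element-index e p)) se))
                 (Vq.index-element i (Vq.element-P i)) }

  private
    matching-rep : ∀ a → OutMatching G R a (rep a)
    matching-rep a = matching (R-rep a)
    module Mr a = OutMatching (matching-rep a)

  rep-edge : E G → E G
  rep-edge e = Mr.to (src G e) e

  rep-edge-src : ∀ e → src G (rep-edge e) ≡ rep (src G e)
  rep-edge-src e = Mr.to-src (src G e) e refl

  private
    rep-edge-rep : ∀ e → rep (src G (rep-edge e)) ≡ src G (rep-edge e)
    rep-edge-rep e = trans (cong rep (rep-edge-src e)) (trans (rep-idem _) (sym (rep-edge-src e)))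

    rep-edge-at : ∀ {I} e → (s : src G e ≡ I) → rep-edge e ≡ Mr.to I e
    rep-edge-at e refl = refl

    ∂π : V G → V Q
    ∂π a = Vq.index (rep a) (rep-idem a)

    φπ : E G → E Q
    φπ e = Eq.index (rep-edge e) (rep-edge-rep e)

  π : RightResolver G Q
  π = mkResolver h ∂-onto li ls
    where
    h : Hom G Q
    h = record
      { ∂ = ∂π ; φ = φπ
      ; src-comm = λ e → Vq.index-cong _ _ _ _ (trans (cong (src G) (Eq.element-index _ _)) (rep-edge-src e))
      ; tgt-comm = λ e → Vq.index-cong _ _ _ _ (rep-cong
          (subst (λ z → R z (tgt G e)) (sym (cong (tgt G) (Eq.element-index _ _))) (Mr.to-tgt (src G e) e refl))) }
    ∂-onto : ∀ y → ∃[ x ] ∂π x ≡ y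
    ∂-onto y = Vq.element y ,
      trans (Vq.index-cong _ _ _ _ (Vq.element-P y)) (Vq.index-element y (Vq.element-P y))
    li : (I : V G) (e₁ e₂ : E G) → src G e₁ ≡ I → src G e₂ ≡ I → φπ e₁ ≡ φπ e₂ → e₁ ≡ e₂
    li I e₁ e₂ s₁ s₂ eq =
      let same-to = trans (sym (rep-edge-at e₁ s₁)) (trans (Eq.index-injective _ _ _ _ eq) (rep-edge-at e₂ s₂))
      in trans (sym (Mr.from-to I e₁ s₁)) (trans (cong (Mr.from I) same-to) (Mr.from-to I e₂ s₂))
    ls : (I : V G) (j : E Q) → src Q j ≡ ∂π I → ∃[ e ] (src G e ≡ I × φπ e ≡ j)
    ls I j s =
      let e₀ = Eq.element j
          s₀ = Vq.index-injective _ _ _ _ s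
          e = Mr.from I e₀
          se = Mr.from-src I e₀ s₀
      in e , se , trans (Eq.index-cong _ _ _ _ (trans (rep-edge-at e se) (Mr.to-from I e₀ s₀)))
                        (Eq.index-element j (Eq.element-P j))

  ∂π-≡⇒R : ∀ a b → ∂ʳ π a ≡ ∂ʳ π b → R a b
  ∂π-≡⇒R a b eq = R-trans (R-rep a) (subst (λ z → R z b) (sym (Vq.index-injective _ _ _ _ eq)) (R-sym (R-rep b)))

  R⇒∂π-≡ : ∀ {a b} → R a b → ∂ʳ π a ≡ ∂ʳ π b
  R⇒∂π-≡ r = Vq.index-cong _ _ _ _ (rep-cong r)

  φπ-≡⇒rep-edge-≡ : ∀ e₁ e₂ → φʳ π e₁ ≡ φʳ π e₂ → rep-edge e₁ ≡ rep-edge e₂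
  φπ-≡⇒rep-edge-≡ e₁ e₂ = Eq.index-injective _ _ _ _

  rep-edge-≡⇒φπ-≡ : ∀ e₁ e₂ → rep-edge e₁ ≡ rep-edge e₂ → φʳ π e₁ ≡ φʳ π e₂
  rep-edge-≡⇒φπ-≡ e₁ e₂ = Eq.index-cong _ _ _ _

-- Identifying ∂Φ a with ∂Φ b whenever ∂Ψ a ≡ ∂Ψ b generates an equivalence on M that is matched along
-- edges (send an edge through its Φ-lift at a and the Ψ-lift at b), so M resolves onto the quotient;
-- minimality of M forces the quotient map to be injective.
module MinimalKernel {G M H : Graph} (Φ : RightResolver G M) (minM : RMinimal M) (Ψ : RightResolver G H) where
  private
    module LΦ = Lifting Φ
    module LΨ = Lifting Ψ
    σ : V G → V M
    σ = ∂ʳ Φ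

  Linked : V M → V M → Set
  Linked I J = ∃[ a ] ∃[ b ] σ a ≡ I × σ b ≡ J × ∂ʳ Ψ a ≡ ∂ʳ Ψ b

  Linked? : ∀ I J → Dec (Linked I J)
  Linked? I J = any? λ a → any? λ b → σ a ≟ I ×-dec σ b ≟ J ×-dec ∂ʳ Ψ a ≟ ∂ʳ Ψ b

  Linked-sym : ∀ {I J} → Linked I J → Linked J I
  Linked-sym (a , b , p , q , r) = b , a , q , p , sym r

  Linked* : V M → V M → Set
  Linked* = Star Linked

  Linked*-equiv : IsEquivalence Linked*
  Linked*-equiv = record { refl = ε ; sym = reverse Linked-sym ; trans = _◅◅_ }

  transport : V G → V G → E M → E M
  transport a b h = φʳ Φ (LΨ.lift b (φʳ Ψ (LΦ.lift a h)))

  module _ (a b : V G) (ψ : ∂ʳ Ψ a ≡ ∂ʳ Ψ b) where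
    private
      e : E M → E G
      e = LΦ.lift a
      x : E M → E G
      x h = LΨ.lift b (φʳ Ψ (e h))
      x-φ : ∀ h → φʳ Ψ (x h) ≡ φʳ Ψ (e h)
      x-φ h = LΨ.lift-φ b _ (trans (LΨ.φ-src _) (trans (cong (∂ʳ Ψ) (LΦ.lift-src a h)) ψ))

    transport-src : ∀ h → src M (transport a b h) ≡ σ b
    transport-src h = trans (LΦ.φ-src _) (cong σ (LΨ.lift-src b _))

    transport-tgt : ∀ h → src M h ≡ σ a → Linked (tgt M (transport a b h)) (tgt M h)
    transport-tgt h s = tgt G (x h) , tgt G (e h) , sym (LΦ.φ-tgt _) ,
      trans (sym (LΦ.φ-tgt _)) (cong (tgt M) (LΦ.lift-φ a h s)) , LΨ.∂-tgt-cong (x-φ h)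

    transport-inverse : ∀ h → src M h ≡ σ a → transport b a (transport a b h) ≡ h
    transport-inverse h s =
      let back-Φ = LΦ.lift-unique b (x h) (LΨ.lift-src b _)
          back-Ψ = trans (cong (LΨ.lift a) (x-φ h)) (LΨ.lift-unique a (e h) (LΦ.lift-src a h))
      in trans (cong (λ z → φʳ Φ (LΨ.lift a (φʳ Ψ z))) back-Φ) (trans (cong (φʳ Φ) back-Ψ) (LΦ.lift-φ a h s))

  Linked-matching : ∀ {I J} → Linked I J → OutMatching M Linked* I J
  Linked-matching (a , b , refl , refl , ψ) = record
    { to = transport a b ; from = transport b a
    ; to-src = λ h _ → transport-src a b ψ h
    ; to-tgt = λ h s → transport-tgt a b ψ h s ◅ ε
    ; from-src = λ h _ → transport-src b a (sym ψ) h
    ; from-to = λ h s → transport-inverse a b ψ h s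
    ; to-from = λ h s → transport-inverse b a (sym ψ) h s }

  Linked*-matching : ∀ {I J} → Linked* I J → OutMatching M Linked* I J
  Linked*-matching {I} ε = OutMatching-refl I ε
  Linked*-matching (l ◅ ls) = OutMatching-trans _◅◅_ (Linked-matching l) (Linked*-matching ls)

  private
    open FiniteReachability _≟_ (allFin (nV M)) ∈-allFin Linked? using () renaming (Star? to Linked*?)
    module N = QuotientGraph M Linked*? Linked*-equiv Linked*-matching
    module N≅M = Iso (minM N.Q N.π)

  ∂N-injective : ∀ I J → ∂ʳ N.π I ≡ ∂ʳ N.π J → I ≡ J
  ∂N-injective I J eq = surjective⇒injective (∂ N≅M.hom ∘ ∂ʳ N.π) onto I J (cong (∂ N≅M.hom) eq)
    where
    onto : ∀ y → ∃[ x ] ∂ N≅M.hom (∂ʳ N.π x) ≡ y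
    onto y = let n , p = proj₂ N≅M.∂-bij y
                 x , q = ∂-surj N.π n
             in x , p (q refl)

  kernel-⊆ : ∀ a b → ∂ʳ Ψ a ≡ ∂ʳ Ψ b → ∂ʳ Φ a ≡ ∂ʳ Φ b
  kernel-⊆ a b ψ = ∂N-injective _ _ (N.R⇒∂π-≡ ((a , b , refl , refl , ψ) ◅ ε))

IsQuotient-Iso : ∀ {G M Q H} (Φ : RightResolver G M) → IsQuotient G M Φ Q → Iso Q H → IsQuotient G M Φ H
IsQuotient-Iso Φ (qV , qE , qV-onto , qE-onto , q-src , q-tgt , kerV , kerE) iso =
  ∂ α ∘ qV , φ α ∘ qE ,
  surjective _≡_ _≡_ _≡_ qV-onto (proj₂ ∂-bij) , surjective _≡_ _≡_ _≡_ qE-onto (proj₂ φ-bij) ,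
  (λ e → trans (src-comm α (qE e)) (cong (∂ α) (q-src e))) ,
  (λ e → trans (tgt-comm α (qE e)) (cong (∂ α) (q-tgt e))) ,
  (λ I₁ I₂ → proj₁ (kerV I₁ I₂) ∘ proj₁ ∂-bij , cong (∂ α) ∘ proj₂ (kerV I₁ I₂)) ,
  (λ e₁ e₂ → proj₁ (kerE e₁ e₂) ∘ proj₁ φ-bij , cong (φ α) ∘ proj₂ (kerE e₁ e₂))
  where
  open Iso iso using (∂-bij; φ-bij) renaming (hom to α)

module StabilityQuotient (G M : Graph) (Φ : RightResolver G M) (minM : RMinimal M) (AB : AlmostBunchy G M Φ)
  where
  private
    module LΦ = Lifting Φ
    σ : V G → V M
    σ = ∂ʳ Φ
  open PairGraph Φ using (Stab; Stab?; Stab-refl; Stab-sym; Stab-trans; Stab-step; Stab⇒Stable; Stable⇒Stab)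

  -- Ξ factors Φ′ = Θ ∘ Ξ with ∂Φ′ = ∂Φ, and almost bunchiness makes Stab the same for Φ′ and Φ.
  module _ {K} (Ξ : RightResolver G K) (ker⊆ : ∀ a b → ∂ʳ Ξ a ≡ ∂ʳ Ξ b → σ a ≡ σ b) where
    private
      open Factorisation Ξ Φ ker⊆ using (factor; factor-∂)
      AB′ : AlmostBunchy G M (factor ∘ʳ Ξ)
      AB′ = AlmostBunchy-∂ Φ (factor ∘ʳ Ξ) factor-∂ AB

    Stab⇒Stab-finer : ∀ {a b} → Stab a b → ∂ʳ Ξ a ≡ ∂ʳ Ξ b → PairGraph.Stab Ξ a b
    Stab⇒Stab-finer s = Composite.Stab-∘⁻ factor Ξ (Stab-same-∂ Φ (factor ∘ʳ Ξ) factor-∂ AB s)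

    Stab-finer⇒Stab : ∀ {a b} → PairGraph.Stab Ξ a b → Stab a b
    Stab-finer⇒Stab s = Stab-same-∂ (factor ∘ʳ Ξ) Φ (sym ∘ factor-∂) AB′ (Composite.Stab-∘⁺ factor Ξ s)

  synchronizing⇒Stab : ∀ {H} (Ψ : RightResolver G H) → Synchronizing Ψ → ∀ a b → ∂ʳ Ψ a ≡ ∂ʳ Ψ b → Stab a b
  synchronizing⇒Stab Ψ sync a b eq =
    Stab-finer⇒Stab Ψ (MinimalKernel.kernel-⊆ Φ minM Ψ) (PairGraph.Stable⇒Stab Ψ a b (sync a b eq))

  Stab-matching : ∀ {a b} → Stab a b → OutMatching G Stab a b
  Stab-matching {a} {b} ab = record
    { to = LΦ.lift b ∘ φʳ Φ ; from = LΦ.lift a ∘ φʳ Φ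
    ; to-src = λ _ _ → LΦ.lift-src b _
    ; to-tgt = λ e s → Stab-step _ e (subst₂ Stab (sym (LΦ.lift-src b _)) (sym s) (Stab-sym ab)) (to-φ e s)
    ; from-src = λ _ _ → LΦ.lift-src a _
    ; from-to = λ e s → trans (cong (LΦ.lift a) (to-φ e s)) (LΦ.lift-unique a e s)
    ; to-from = λ e s → trans (cong (LΦ.lift b) (from-φ e s)) (LΦ.lift-unique b e s) }
    where
    to-φ : ∀ e → src G e ≡ a → φʳ Φ (LΦ.lift b (φʳ Φ e)) ≡ φʳ Φ e
    to-φ e s = LΦ.lift-φ b _ (trans (LΦ.φ-src e) (trans (cong σ s) (proj₁ ab)))
    from-φ : ∀ e → src G e ≡ b → φʳ Φ (LΦ.lift a (φʳ Φ e)) ≡ φʳ Φ e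
    from-φ e s = LΦ.lift-φ a _ (trans (LΦ.φ-src e) (trans (cong σ s) (sym (proj₁ ab))))

  Stab-equiv : IsEquivalence Stab
  Stab-equiv = record { refl = Stab-refl _ ; sym = Stab-sym ; trans = Stab-trans }

  open QuotientGraph G Stab? Stab-equiv Stab-matching using (Q; π; R-rep; rep-cong; rep-edge; ∂π-≡⇒R; R⇒∂π-≡;
    φπ-≡⇒rep-edge-≡; rep-edge-≡⇒φπ-≡) public

  π-synchronizing : Synchronizing π
  π-synchronizing a b eq = PairGraph.Stab⇒Stable π a b
    (Stab⇒Stab-finer π (λ a b → proj₁ ∘ ∂π-≡⇒R a b) (∂π-≡⇒R a b eq) eq)

  Q-IsQuotient : IsQuotient G M Φ Q
  Q-IsQuotient = ∂ʳ π , φʳ π , ∂-surj π , φ-surj π , src-comm (hom π) , tgt-comm (hom π) ,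
    (λ a b → Stab⇒Stable a b ∘ ∂π-≡⇒R a b , R⇒∂π-≡ ∘ Stable⇒Stab a b) ,
    (λ e₁ e₂ → φπ-≡⇒Φ-kernel e₁ e₂ , Φ-kernel⇒φπ-≡ e₁ e₂)
    where
    rep-edge-φ : ∀ e → φʳ Φ (rep-edge e) ≡ φʳ Φ e
    rep-edge-φ e = LΦ.lift-φ _ _ (trans (LΦ.φ-src e) (proj₁ (R-rep (src G e))))
    φπ-≡⇒Φ-kernel : ∀ e₁ e₂ → φʳ π e₁ ≡ φʳ π e₂ → φʳ Φ e₁ ≡ φʳ Φ e₂ × Stable Φ (src G e₁) (src G e₂)
    φπ-≡⇒Φ-kernel e₁ e₂ eq =
      trans (sym (rep-edge-φ e₁)) (trans (cong (φʳ Φ) (φπ-≡⇒rep-edge-≡ e₁ e₂ eq)) (rep-edge-φ e₂)) ,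
      Stab⇒Stable _ _ (∂π-≡⇒R _ _ (Lifting.∂-src-cong π eq))
    Φ-kernel⇒φπ-≡ : ∀ e₁ e₂ → φʳ Φ e₁ ≡ φʳ Φ e₂ × Stable Φ (src G e₁) (src G e₂) → φʳ π e₁ ≡ φʳ π e₂
    Φ-kernel⇒φπ-≡ e₁ e₂ (eq , s) =
      rep-edge-≡⇒φπ-≡ e₁ e₂ (cong₂ LΦ.lift (rep-cong (Stable⇒Stab _ _ s)) eq)

  -- Λ ∘ π is synchronizing, so any two states it identifies are stable, hence already identified by π.
  Q-SMinimal : SMinimal Q
  Q-SMinimal K (Λ , Λ-sync) = Iso-from-∂-injective Λ ∂Λ-injective
    where
    module Lπ = Lifting π
    ∂Λ-injective : ∀ x y → ∂ʳ Λ x ≡ ∂ʳ Λ y → x ≡ y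
    ∂Λ-injective x y eq = begin
      x                     ≡⟨ Lπ.∂-preimage x ⟨
      ∂ʳ π (Lπ.preimage x)  ≡⟨ R⇒∂π-≡ preimages-stable ⟩
      ∂ʳ π (Lπ.preimage y)  ≡⟨ Lπ.∂-preimage y ⟩
      y                     ∎
      where
      open ≡-Reasoning
      preimages-stable : Stab (Lπ.preimage x) (Lπ.preimage y)
      preimages-stable = synchronizing⇒Stab (Λ ∘ʳ π) (Composite.Synchronizing-∘ Λ π Λ-sync π-synchronizing)
        _ _ (Composite.∂-∘-preimage Λ π eq)

  -- π factors through Ψ, and the factor is synchronizing; minimality of H makes it an isomorphism.
  SMinimal⇒IsQuotient : (H : Graph) → H ≤S G → SMinimal H → IsQuotient G M Φ H
  SMinimal⇒IsQuotient H (Ψ , Ψ-sync) minH = IsQuotient-Iso Φ Q-IsQuotient (minH Q (ρ , ρ-sync))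
    where
    module LΨ = Lifting Ψ
    open Factorisation Ψ π (λ a b → R⇒∂π-≡ ∘ synchronizing⇒Stab Ψ Ψ-sync a b)
      using () renaming (factor to ρ; factor-∂ to ρ-∂)
    ∂ρΨ-≡⇒∂π-≡ : ∀ {a b} → ∂ʳ (ρ ∘ʳ Ψ) a ≡ ∂ʳ (ρ ∘ʳ Ψ) b → ∂ʳ π a ≡ ∂ʳ π b
    ∂ρΨ-≡⇒∂π-≡ {a} {b} eq = trans (sym (ρ-∂ a)) (trans eq (ρ-∂ b))
    ρ-sync : Synchronizing ρ
    ρ-sync x y eq = PairGraph.Stab⇒Stable ρ x y
      (subst₂ (PairGraph.Stab ρ) (LΨ.∂-preimage x) (LΨ.∂-preimage y) (Composite.Stab-image ρ Ψ
        (Stab⇒Stab-finer (ρ ∘ʳ Ψ) (λ a b → proj₁ ∘ ∂π-≡⇒R a b ∘ ∂ρΨ-≡⇒∂π-≡)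
          (∂π-≡⇒R _ _ (∂ρΨ-≡⇒∂π-≡ ρΨ-eq)) ρΨ-eq)))
      where
      ρΨ-eq : ∂ʳ (ρ ∘ʳ Ψ) (LΨ.preimage x) ≡ ∂ʳ (ρ ∘ʳ Ψ) (LΨ.preimage y)
      ρΨ-eq = Composite.∂-∘-preimage ρ Ψ eq

theorem5p8 : (G M : Graph) (Φ : RightResolver G M) → RMinimal M → AlmostBunchy G M Φ →
    ((H : Graph) → H ≤S G → SMinimal H → IsQuotient G M Φ H)
    × Σ Graph (λ Q → IsQuotient G M Φ Q × Q ≤S G × SMinimal Q)
theorem5p8 G M Φ minM AB = SMinimal⇒IsQuotient , Q , Q-IsQuotient , (π , π-synchronizing) , Q-SMinimal
  where open StabilityQuotient G M Φ minM AB
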